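{- Let $k,n$ be positive integers. If there is a coloring $\chi:[n]\times[n]\to[k]$ of the $n\times n$ grid with no monochromatic rectangle that has the shift pattern, then $n\le k^2$ or $n\ge k^2+k$.
   Context: Cells of the $n\times n$ grid are $(r,s)\in[n]\times[n]$ ($r$ the row, $s$ the column). A monochromatic rectangle is a set of four distinct cells $(a,b),(a,d),(c,b),(c,d)$ all of the same color. A coloring $\chi$ of the $n\times n$ grid has the shift pattern if every row is a cyclic shift of the first row, the $r$-th row being shifted by $r-1$ positions in a fixed direction (with wrap-around): i.e. either $\chi(r,s)=\chi(1,((s-r)\bmod n)+1)$ for all $r,s$ (right shift) or $\chi(r,s)=\chi(1,((s+r-2)\bmod n)+1)$ for all $r,s$ (left shift). -}

module Defs where

open import Data.Nat using (ℕ; suc; _+_; _∸_)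
open import Data.Nat.DivMod using (_mod_)
open import Data.Fin using (Fin; toℕ)
open import Data.Fin as F using ()
open import Data.Product using (Σ-syntax; _×_)
open import Data.Sum using (_⊎_)
open import Relation.Binary.PropositionalEquality using (_≡_; _≢_)

-- Cells of the n×n grid are (r , s) : Fin n × Fin n, with the 1-based row r+1 / column s+1
-- of the paper corresponding to the 0-based index r / s here. Colors [k] are Fin k.
Coloring : ℕ → ℕ → Set
Coloring n k = Fin n → Fin n → Fin k

HasMonoRectangle : ∀ {n k} → Coloring n k → Set
HasMonoRectangle {n} χ =
  Σ[ a ∈ Fin n ] Σ[ c ∈ Fin n ] Σ[ b ∈ Fin n ] Σ[ d ∈ Fin n ]
    (a ≢ c) × (b ≢ d) ×
    (χ a b ≡ χ a d) × (χ a b ≡ χ c b) × (χ a b ≡ χ c d)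

modFin : (m' : ℕ) → ℕ → Fin (suc m')
modFin m' x = x mod (suc m')

-- Paper's right shift χ(r,s) = χ(1, ((s-r) mod n)+1) becomes
-- χ r s = χ 0 ((s - r) mod n) = χ 0 ((s + n - r) mod n); left shift
-- χ(r,s) = χ(1, ((s+r-2) mod n)+1) becomes χ r s = χ 0 ((s + r) mod n).
RightShift : ∀ {m' k} → Coloring (suc m') k → Set
RightShift {m'} χ = ∀ r s →
  χ r s ≡ χ F.zero (modFin m' ((toℕ s + suc m') ∸ toℕ r))

LeftShift : ∀ {m' k} → Coloring (suc m') k → Set
LeftShift {m'} χ = ∀ r s →
  χ r s ≡ χ F.zero (modFin m' (toℕ s + toℕ r))

HasShiftPattern : ∀ {m' k} → Coloring (suc m') k → Set
HasShiftPattern χ = RightShift χ ⊎ LeftShift χ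

-- Suppose k² < n ≤ (k+1)k. By pigeonhole the first row has k+1 cells of one colour, and the
-- (k+1)k ordered pairs of distinct such cells have nonzero differences mod n, of which there
-- are only n-1 < (k+1)k; so two pairs (x , y) ≠ (x' , y') satisfy x - y ≡ x' - y', and
-- x ≠ x'. In a shift-pattern colouring the row c = ±(x - x') is the first row translated by
-- x' - x, so it has the colours of x' and y' in the columns x and y: rows 0 and c, columns
-- x and y form a monochromatic rectangle.
module Submission where

open import Defs
open import Data.Nat using (ℕ; suc; _+_; _*_; _≤_; _≥_)
open import Data.Product using (Σ-syntax; _×_)
open import Data.Sum using (_⊎_)
open import Relation.Nullary using (¬_)

open import Data.Bool using (true; false)
open import Data.Empty using (⊥-elim)
open import Data.Fin as F using (Fin; toℕ; punchIn; punchOut; remQuot; inject≤)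
open import Data.Fin.Properties
  using (toℕ-injective; toℕ<n; toℕ-fromℕ<; pigeonhole; punchOut-injective; punchIn-injective;
         punchInᵢ≢i; combine-remQuot; inject≤-injective)
open import Data.List using (List; []; _∷_; length; filter; lookup; allFin)
open import Data.List.Properties using (length-tabulate)
open import Data.List.Membership.Propositional.Properties using (∈-lookup)
open import Data.List.Relation.Binary.Sublist.Propositional using (_⊆_)
open import Data.List.Relation.Binary.Sublist.Propositional.Properties as Sublist
  using (length-mono-≤; filter-⊆)
open import Data.List.Relation.Unary.All as All using (All; []; _∷_)
import Data.List.Relation.Unary.All.Properties as All
open import Data.List.Relation.Unary.AllPairs using (_∷_)
open import Data.List.Relation.Unary.Unique.Propositional using (Unique)
import Data.List.Relation.Unary.Unique.Propositional.Properties as Unique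
open import Data.Nat using (zero; _<_; _∸_; _%_; s≤s⁻¹; _≟_; _<?_; _≤?_)
open import Data.Nat.DivMod using (%-distribˡ-+; m%n%n≡m%n; [m+n]%n≡m%n; [m+kn]%n≡m%n; m<n⇒m%n≡m)
open import Data.Nat.Properties
open import Algebra.Properties.CommutativeSemigroup +-commutativeSemigroup using (xy∙z≈xz∙y)
open import Data.Product using (_,_; ∃₂; uncurry; map₂)
open import Data.Sum using (inj₁; inj₂)
open import Function using (_∘_; Injective)
open import Level using (Level; 0ℓ)
open import Relation.Binary.Bundles using (Setoid)
open import Relation.Binary.PropositionalEquality
import Relation.Binary.Reasoning.Setoid as ≈-Reasoning
open import Relation.Nullary using (does; yes; no)
open import Relation.Unary using (Pred; Decidable)
open import Relation.Unary.Properties using (∁?)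

private
  variable
    ℓ : Level
    A : Set

length-filter+filter-∁ : {P : Pred A ℓ} (P? : Decidable P) (xs : List A) →
  length xs ≡ length (filter P? xs) + length (filter (∁? P?) xs)
length-filter+filter-∁ P? [] = refl
length-filter+filter-∁ P? (x ∷ xs) with does (P? x)
... | true  = cong suc (length-filter+filter-∁ P? xs)
... | false = trans (cong suc (length-filter+filter-∁ P? xs)) (sym (+-suc _ _))

Unique⇒lookup-injective : {xs : List A} → Unique xs → Injective _≡_ _≡_ (lookup xs)
Unique⇒lookup-injective {xs = _ ∷ _} (_ ∷ _) {F.zero} {F.zero} _ = refl
Unique⇒lookup-injective {xs = _ ∷ _} (x∉ ∷ _) {F.zero} {F.suc j} e =
  ⊥-elim (All.lookup x∉ (∈-lookup j) e)
Unique⇒lookup-injective {xs = _ ∷ _} (x∉ ∷ _) {F.suc i} {F.zero} e =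
  ⊥-elim (All.lookup x∉ (∈-lookup i) (sym e))
Unique⇒lookup-injective {xs = _ ∷ _} (_ ∷ u) {F.suc i} {F.suc j} e =
  cong F.suc (Unique⇒lookup-injective u e)

module _ (h : A → ℕ) where

  fibre : ℕ → List A → List A
  fibre c = filter (λ x → h x ≟ c)

  pigeonhole-fibre : ∀ k m (xs : List A) → All (λ x → h x < k) xs → k * m < length xs →
    Σ[ c ∈ ℕ ] m < length (fibre c xs)
  pigeonhole-fibre zero m [] _ ()
  pigeonhole-fibre zero m (x ∷ xs) (() ∷ _) _
  pigeonhole-fibre (suc k) m xs h<1+k km<|xs| with m <? length (fibre k xs)
  ... | yes m<|fibre| = k , m<|fibre|
  ... | no m≮|fibre| =
    map₂ (λ {c} m<|fibre′| → <-≤-trans m<|fibre′| (length-mono-≤ (fibre-rest-⊆ c)))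
         (pigeonhole-fibre k m rest h<k (+-cancelˡ-< m _ _ m+km<m+|rest|))
    where
    rest : List A
    rest = filter (∁? (λ x → h x ≟ k)) xs
    fibre-rest-⊆ : ∀ c → fibre c rest ⊆ fibre c xs
    fibre-rest-⊆ c = Sublist.filter⁺ _ _ (λ { refl p → p }) (filter-⊆ _ xs)
    h<k : All (λ x → h x < k) rest
    h<k = All.zipWith (λ (h<1+k , h≢k) → ≤∧≢⇒< (s≤s⁻¹ h<1+k) h≢k)
            (All.filter⁺ _ h<1+k , All.all-filter _ xs)
    m+km<m+|rest| : m + k * m < m + length rest
    m+km<m+|rest| = <-≤-trans km<|xs|
      (≤-trans (≤-reflexive (length-filter+filter-∁ (λ x → h x ≟ k) xs))
               (+-monoˡ-≤ _ (≮⇒≥ m≮|fibre|)))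

large-fibre : ∀ {N k m} (f : Fin N → Fin k) → k * m < N →
  Σ[ κ ∈ Fin k ] Σ[ g ∈ (Fin (suc m) → Fin N) ] Injective _≡_ _≡_ g × (∀ i → f (g i) ≡ κ)
large-fibre {N} {k} {m} f km<N
  with c , m<|S| ← pigeonhole-fibre (toℕ ∘ f) k m (allFin N) (All.universal (toℕ<n ∘ f) _)
                     (subst (k * m <_) (sym (length-tabulate _)) km<N)
  = f (g F.zero) , g , g-injective , λ i → toℕ-injective (trans (h∘g i) (sym (h∘g F.zero)))
  where
  h : Fin N → ℕ
  h = toℕ ∘ f
  S : List (Fin N)
  S = fibre h c (allFin N)
  g : Fin (suc m) → Fin N
  g i = lookup S (inject≤ i m<|S|)
  g-injective : Injective _≡_ _≡_ g
  g-injective =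
    inject≤-injective _ _ _ _ ∘ Unique⇒lookup-injective (Unique.filter⁺ _ (Unique.allFin⁺ N))
  h∘g : ∀ i → h (g i) ≡ c
  h∘g i = All.lookup (All.all-filter _ (allFin N)) (∈-lookup (inject≤ i m<|S|))

pigeonhole-× : ∀ {a b m} → m < a * b → (f : Fin a → Fin b → Fin m) →
  Σ[ u ∈ Fin a × Fin b ] Σ[ v ∈ Fin a × Fin b ] u ≢ v × uncurry f u ≡ uncurry f v
pigeonhole-× {a} {b} m<ab f with p , q , p<q , fp≡fq ← pigeonhole m<ab (uncurry f ∘ remQuot b)
  = remQuot b p , remQuot b q , <⇒≢ p<q ∘ cong toℕ ∘ remQuot-injective , fp≡fq
  where
  remQuot-injective : remQuot {a} b p ≡ remQuot b q → p ≡ q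
  remQuot-injective e =
    trans (sym (combine-remQuot {a} b p)) (trans (cong (uncurry F.combine) e) (combine-remQuot {a} b q))

module Modulo (n' : ℕ) where

  N : ℕ
  N = suc n'

  -- A record rather than a definition, so that a and b can be inferred from a ≈ b.
  infix 4 _≈_
  record _≈_ (a b : ℕ) : Set where
    constructor ≈-intro
    field %-≡ : a % N ≡ b % N

  ≈-setoid : Setoid 0ℓ 0ℓ
  ≈-setoid = record
    { Carrier       = ℕ
    ; _≈_           = _≈_
    ; isEquivalence = record
      { refl  = ≈-intro refl
      ; sym   = λ (≈-intro p) → ≈-intro (sym p)
      ; trans = λ (≈-intro p) (≈-intro q) → ≈-intro (trans p q)
      }
    }

  open Setoid ≈-setoid public using () renaming (refl to ≈-refl; trans to ≈-trans)

  %-≈ : ∀ a → a % N ≈ a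
  %-≈ a = ≈-intro (m%n%n≡m%n a N)

  +-multiple-≈ : ∀ a c → a + c * N ≈ a
  +-multiple-≈ a c = ≈-intro ([m+kn]%n≡m%n a c N)

  +-cong-≈ : ∀ {a a' b b'} → a ≈ a' → b ≈ b' → a + b ≈ a' + b'
  +-cong-≈ {a} {a'} {b} {b'} (≈-intro a≈a') (≈-intro b≈b') = ≈-intro (begin
    (a + b) % N            ≡⟨ %-distribˡ-+ a b N ⟩
    (a % N + b % N) % N    ≡⟨ cong₂ (λ u v → (u + v) % N) a≈a' b≈b' ⟩
    (a' % N + b' % N) % N  ≡⟨ %-distribˡ-+ a' b' N ⟨
    (a' + b') % N          ∎)
    where open ≡-Reasoning

  -- Adding n' * c turns the summand c into the multiple c * N.
  +-cancelʳ-≈ : ∀ {a b} c → a + c ≈ b + c → a ≈ b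
  +-cancelʳ-≈ {a} {b} c a+c≈b+c = begin
    a               ≈⟨ +-multiple-≈ a c ⟨
    a + c * N       ≡⟨ complete a ⟨
    a + c + n' * c  ≈⟨ +-cong-≈ a+c≈b+c ≈-refl ⟩
    b + c + n' * c  ≡⟨ complete b ⟩
    b + c * N       ≈⟨ +-multiple-≈ b c ⟩
    b               ∎
    where
    open ≈-Reasoning ≈-setoid
    complete : ∀ x → x + c + n' * c ≡ x + c * N
    complete x = trans (+-assoc x c (n' * c)) (cong (x +_) (*-comm N c))

  parallelogram : ∀ {x y x' y' d c} → y + d ≈ x → y' + d ≈ x' → x' + c ≈ x → y' + c ≈ y
  parallelogram {x} {y} {x'} {y'} {d} {c} y+d≈x y'+d≈x' x'+c≈x = +-cancelʳ-≈ d (begin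
    y' + c + d  ≡⟨ xy∙z≈xz∙y y' c d ⟩
    y' + d + c  ≈⟨ +-cong-≈ y'+d≈x' ≈-refl ⟩
    x' + c      ≈⟨ x'+c≈x ⟩
    x           ≈⟨ y+d≈x ⟨
    y + d       ∎)
    where open ≈-Reasoning ≈-setoid

  ≈⇒≡ : ∀ {u v : Fin N} → toℕ u ≈ toℕ v → u ≡ v
  ≈⇒≡ {u} {v} (≈-intro u≈v) = toℕ-injective (begin
    toℕ u      ≡⟨ m<n⇒m%n≡m (toℕ<n u) ⟨
    toℕ u % N  ≡⟨ u≈v ⟩
    toℕ v % N  ≡⟨ m<n⇒m%n≡m (toℕ<n v) ⟩
    toℕ v      ∎)
    where open ≡-Reasoning

  toℕ-modFin : ∀ z → toℕ (modFin n' z) ≈ z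
  toℕ-modFin z = subst (_≈ z) (sym (toℕ-fromℕ< _)) (%-≈ z)

  -- Spelled exactly as the column indices in RightShift and LeftShift. They reduce to _%_, so
  -- their arguments are never inferred from a result and are passed explicitly below.
  infixl 6 _⊖_ _⊕_
  _⊖_ _⊕_ : Fin N → Fin N → Fin N
  s ⊖ r = modFin n' (toℕ s + N ∸ toℕ r)
  s ⊕ r = modFin n' (toℕ s + toℕ r)

  ⊖-spec : ∀ s r → toℕ r + toℕ (s ⊖ r) ≈ toℕ s
  ⊖-spec s r = begin
    toℕ r + toℕ (s ⊖ r)          ≈⟨ +-cong-≈ (≈-refl {toℕ r}) (toℕ-modFin _) ⟩
    toℕ r + (toℕ s + N ∸ toℕ r)  ≡⟨ m+[n∸m]≡n r≤s+N ⟩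
    toℕ s + N                    ≈⟨ ≈-intro ([m+n]%n≡m%n (toℕ s) N) ⟩
    toℕ s                        ∎
    where
    open ≈-Reasoning ≈-setoid
    r≤s+N : toℕ r ≤ toℕ s + N
    r≤s+N = ≤-trans (<⇒≤ (toℕ<n r)) (m≤n+m N (toℕ s))

  ⊖-unique : ∀ {s r u} → toℕ u + toℕ r ≈ toℕ s → s ⊖ r ≡ u
  ⊖-unique {s} {r} {u} u+r≈s = ≈⇒≡ (+-cancelʳ-≈ (toℕ r) (begin
    toℕ (s ⊖ r) + toℕ r  ≡⟨ +-comm (toℕ (s ⊖ r)) (toℕ r) ⟩
    toℕ r + toℕ (s ⊖ r)  ≈⟨ ⊖-spec s r ⟩
    toℕ s                ≈⟨ u+r≈s ⟨
    toℕ u + toℕ r        ∎))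
    where open ≈-Reasoning ≈-setoid

  ⊖-self : ∀ s → s ⊖ s ≡ F.zero
  ⊖-self s = ⊖-unique {s} {s} {F.zero} ≈-refl

  ⊖-injectiveʳ : ∀ {s r r'} → s ⊖ r ≡ s ⊖ r' → r ≡ r'
  ⊖-injectiveʳ {s} {r} {r'} s⊖r≡s⊖r' = ≈⇒≡ (+-cancelʳ-≈ (toℕ (s ⊖ r)) (begin
    toℕ r + toℕ (s ⊖ r)    ≈⟨ ⊖-spec s r ⟩
    toℕ s                  ≈⟨ ⊖-spec s r' ⟨
    toℕ r' + toℕ (s ⊖ r')  ≡⟨ cong (λ d → toℕ r' + toℕ d) s⊖r≡s⊖r' ⟨
    toℕ r' + toℕ (s ⊖ r)   ∎))
    where open ≈-Reasoning ≈-setoid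

  ⊖≡0⇒≡ : ∀ {s r} → s ⊖ r ≡ F.zero → r ≡ s
  ⊖≡0⇒≡ {s} s⊖r≡0 = ⊖-injectiveʳ (trans s⊖r≡0 (sym (⊖-self s)))

  ⊖-spec-≡ : ∀ {x y x' y'} → x ⊖ y ≡ x' ⊖ y' → toℕ y' + toℕ (x ⊖ y) ≈ toℕ x'
  ⊖-spec-≡ {x' = x'} {y'} same =
    subst (λ d → toℕ y' + toℕ d ≈ toℕ x') (sym same) (⊖-spec x' y')

  ⊕-unique : ∀ {s r u} → toℕ s + toℕ r ≈ toℕ u → s ⊕ r ≡ u
  ⊕-unique s+r≈u = ≈⇒≡ (≈-trans (toℕ-modFin _) s+r≈u)

  module _ {m} {g : Fin (suc m) → Fin N} (g-injective : Injective _≡_ _≡_ g) where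

    private
      g≢g∘punchIn : ∀ i k → g i ≢ g (punchIn i k)
      g≢g∘punchIn i k = punchInᵢ≢i i k ∘ sym ∘ g-injective

      0≢difference : ∀ i k → F.zero ≢ g i ⊖ g (punchIn i k)
      0≢difference i k = g≢g∘punchIn i k ∘ sym ∘ ⊖≡0⇒≡ {g i} {g (punchIn i k)} ∘ sym

      difference : Fin (suc m) → Fin m → Fin n'
      difference i k = punchOut (0≢difference i k)

      same-difference : ∀ {i k i' k'} → difference i k ≡ difference i' k' →
        g i ⊖ g (punchIn i k) ≡ g i' ⊖ g (punchIn i' k')
      same-difference {i} {k} {i'} {k'} = punchOut-injective (0≢difference i k) (0≢difference i' k')

      punchIn-pair-injective : ∀ {i k i' k'} → i ≡ i' → g (punchIn i k) ≡ g (punchIn i' k') →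
        (i , k) ≡ (i' , k')
      punchIn-pair-injective {i} {k} refl e = cong (i ,_) (punchIn-injective i k _ (g-injective e))

      distinct-pairs : ∀ {i k i' k'} → (i , k) ≢ (i' , k') →
        difference i k ≡ difference i' k' → g i ≢ g i'
      distinct-pairs {i} {k} {i'} {k'} ik≢i'k' same gi≡gi' =
        ik≢i'k' (punchIn-pair-injective (g-injective gi≡gi')
          (⊖-injectiveʳ {g i} {g (punchIn i k)} {g (punchIn i' k')}
            (trans (same-difference same) (cong (_⊖ g (punchIn i' k')) (sym gi≡gi')))))

    repeated-difference : N ≤ suc m * m →
      ∃₂ λ i j → ∃₂ λ i' j' → g i ≢ g j × g i ≢ g i' × g i ⊖ g j ≡ g i' ⊖ g j'
    -- `let`, not `with`: abstracting over these ⊖-types makes Agda normalise _%_ at length.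
    repeated-difference N≤[1+m]m =
      let (i , k) , (i' , k') , ik≢i'k' , same = pigeonhole-× N≤[1+m]m difference
      in i , punchIn i k , i' , punchIn i' k'
       , g≢g∘punchIn i k , distinct-pairs ik≢i'k' same , same-difference same

module _ {n' k : ℕ} (χ : Coloring (suc n') k) where
  open Modulo n'

  translating-row : HasShiftPattern χ → ∀ {x x'} → x ≢ x' →
    Σ[ c ∈ Fin N ] c ≢ F.zero × (∀ {y y'} → x ⊖ y ≡ x' ⊖ y' → χ c y ≡ χ F.zero y')
  translating-row (inj₁ right) {x} {x'} x≢x' =
    x ⊖ x' , x≢x' ∘ sym ∘ ⊖≡0⇒≡ {x} {x'} , λ {y} {y'} same →
      trans (right (x ⊖ x') y) (cong (χ F.zero) (⊖-unique {y} {x ⊖ x'} {y'}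
        (parallelogram (⊖-spec x y) (⊖-spec-≡ {x} {y} {x'} {y'} same) (⊖-spec x x'))))
  translating-row (inj₂ left) {x} {x'} x≢x' =
    x' ⊖ x , x≢x' ∘ ⊖≡0⇒≡ {x'} {x} , λ {y} {y'} same →
      trans (left (x' ⊖ x) y) (cong (χ F.zero) (⊕-unique {y} {x' ⊖ x} {y'}
        (parallelogram (⊖-spec-≡ {x} {y} {x'} {y'} same) (⊖-spec x y) (⊖-spec x' x))))

  monoRectangle : HasShiftPattern χ → ∀ {κ x y x' y'} →
    x ≢ y → x ≢ x' → x ⊖ y ≡ x' ⊖ y' →
    χ F.zero x ≡ κ → χ F.zero y ≡ κ → χ F.zero x' ≡ κ → χ F.zero y' ≡ κ →
    HasMonoRectangle χ
  monoRectangle shift {x = x} {y} {x'} {y'} x≢y x≢x' same κx κy κx' κy' =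
    let c , c≢0 , translate = translating-row shift x≢x'
    in F.zero , c , x , y , c≢0 ∘ sym , x≢y
     , trans κx (sym κy)
     , trans κx (sym (trans (translate {x} {x'} (trans (⊖-self x) (sym (⊖-self x')))) κx'))
     , trans κx (sym (trans (translate {y} {y'} same) κy'))

  monoRectangle-between : HasShiftPattern χ → k * k < N → N ≤ suc k * k → HasMonoRectangle χ
  monoRectangle-between shift k²<N N≤[1+k]k =
    let κ , g , g-injective , colour = large-fibre (χ F.zero) k²<N
        i , j , i' , j' , gi≢gj , gi≢gi' , same = repeated-difference g-injective N≤[1+k]k
    in monoRectangle shift gi≢gj gi≢gi' same (colour i) (colour j) (colour i') (colour j')

corollary1 : (k' n' : ℕ) →
    (Σ[ χ ∈ Coloring (suc n') (suc k') ] (¬ HasMonoRectangle χ × HasShiftPattern χ)) →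
    (suc n' ≤ suc k' * suc k') ⊎ (suc n' ≥ suc k' * suc k' + suc k')
corollary1 k' n' (χ , no-rectangle , shift) with suc n' ≤? suc k' * suc k'
... | yes n≤k² = inj₁ n≤k²
... | no n≰k² with suc k' * suc k' + suc k' ≤? suc n'
...   | yes k²+k≤n = inj₂ k²+k≤n
...   | no k²+k≰n = ⊥-elim (no-rectangle (monoRectangle-between χ shift (≰⇒> n≰k²) n≤[1+k]k))
  where
  n≤[1+k]k : suc n' ≤ suc (suc k') * suc k'
  n≤[1+k]k = ≤-trans (<⇒≤ (≰⇒> k²+k≰n)) (≤-reflexive (+-comm (suc k' * suc k') (suc k')))
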